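{- For every integer $d\ge 0$: (a) $\tilde{A}_d\subseteq\tilde{A}_k$ for each $0\le k\le d$; in particular $\tilde{A}_d\subseteq\tilde{A}_0$ and $\tilde{A}_{d+1}\subseteq\tilde{A}_d$. (b) $\tilde{A}_d=\tilde{A}_0\cap\hat{A}_d$.
   Context: All sequences are finite words $\alpha=a_1\ldots a_n$ ($n\ge0$) of positive integers. For an integer $d\ge 0$, an index $i\in[n]$ is a $d$-ascent of $\alpha$ if $i=1$, or $i\ge 2$ and $a_i>a_{i-1}-d$; $\mathrm{asc}_d\alpha$ is the number of $d$-ascents. $\alpha$ is a $d$-ascent sequence if $a_i\le1+\mathrm{asc}_d(a_1\ldots a_{i-1})$ for all $i\in[n]$; $A_d$ is the set of all $d$-ascent sequences. For a word $\alpha$ and index $j$, $M(\alpha,j)$ adds $1$ to every $a_i$ with $i<j$ and $a_i\ge a_j$; $M(\alpha,j_1,\dots,j_k)=M(M(\alpha,j_1,\dots,j_{k-1}),j_k)$. For $\alpha\in A_d$, $\mathrm{hat}_d(\alpha)=M(\alpha,j_1,\dots,j_k)$ with $j_1<\dots<j_k$ the $d$-ascents of $\alpha$. $\hat{A}_d=\{\mathrm{hat}_d(\alpha):\alpha\in A_d\}$ and $\tilde{A}_d=\{\alpha\in A_d:\mathrm{hat}_d(\alpha)=\alpha\}$. -}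

module Defs where

open import Data.Nat using (ℕ; zero; suc; _+_; _∸_; _≤_; _<_; _>_; _≤?_; _<?_)
open import Data.List using (List; []; _∷_; _++_; length; foldl; reverse)
open import Data.List.Relation.Unary.All using (All)
open import Data.Bool using (Bool; true; false; if_then_else_)
open import Data.Product using (Σ; _×_; ∃)
open import Relation.Nullary.Decidable using (does)
open import Relation.Binary.PropositionalEquality using (_≡_)

-- Words are lists of natural numbers; positivity is imposed where needed.
Word : Set
Word = List ℕ

-- 1-based lookup; returns 0 out of range (never used out of range in a meaningful way)
at : Word → ℕ → ℕ
at []       _             = 0
at (x ∷ xs) zero          = 0
at (x ∷ xs) (suc zero)    = x
at (x ∷ xs) (suc (suc i)) = at xs (suc i)

-- index i (1-based) of α is a d-ascent: i = 1, or i ≥ 2 and a_i > a_{i-1} - d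
-- (a_i > a_{i-1} - d over the integers, i.e. a_i + d > a_{i-1})
isAscB : ℕ → Word → ℕ → Bool
isAscB d α zero          = false
isAscB d α (suc zero)    = true
isAscB d α (suc (suc i)) = does (at α (suc i) <? at α (suc (suc i)) + d)

ascListFrom : ℕ → Word → ℕ → ℕ → List ℕ
ascListFrom d α i zero    = []
ascListFrom d α i (suc k) =
  if isAscB d α i then i ∷ ascListFrom d α (suc i) k else ascListFrom d α (suc i) k

ascents : ℕ → Word → List ℕ
ascents d α = ascListFrom d α 1 (length α)

asc : ℕ → Word → ℕ
asc d α = length (ascents d α)

-- d-ascent sequence: every entry positive and a_i ≤ 1 + asc_d(a_1 … a_{i-1})
-- checked via prefixes: build from the left
isAscSeqAux : ℕ → Word → Word → Set
isAscSeqAux d pre []       = Data.Unit.⊤ where import Data.Unit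
isAscSeqAux d pre (x ∷ xs) =
  (1 ≤ x) × (x ≤ 1 + asc d pre) × isAscSeqAux d (pre ++ (x ∷ [])) xs

IsAscSeq : ℕ → Word → Set
IsAscSeq d α = isAscSeqAux d [] α

-- M(α, j): add 1 to every a_i with i < j and a_i ≥ a_j  (j 1-based)
Mgo : ℕ → Word → ℕ → Word
Mgo v []       _             = []
Mgo v (x ∷ xs) zero          = x ∷ xs
Mgo v (x ∷ xs) (suc zero)    = x ∷ xs
Mgo v (x ∷ xs) (suc (suc k)) =
  (if does (v ≤? x) then suc x else x) ∷ Mgo v xs (suc k)

M : Word → ℕ → Word
M α j = Mgo (at α j) α j

Ms : Word → List ℕ → Word
Ms α js = foldl M α js

hat : ℕ → Word → Word
hat d α = Ms α (ascents d α)

InTilde : ℕ → Word → Set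
InTilde d α = IsAscSeq d α × hat d α ≡ α

InHat : ℕ → Word → Set
InHat d α = Σ Word (λ β → IsAscSeq d β × hat d β ≡ α)

-- If hat_d α = α and i is a d-ascent of α with a_i ≤ a_{i-1}, the move M(·, i) raises a_{i-1},
-- the earlier moves leave a_{i-1} and a_i alone and no move lowers an entry, so hat_d α ≠ α.
-- Hence the d-ascents of a fixed point are 0-ascents; as 0-ascents ⊆ k-ascents ⊆ d-ascents for
-- k ≤ d, all these sets coincide, and then Ã_k and Ã_d are defined by the same conditions.
--
-- For α = hat_d β ∈ Ã_0: a descent a_i + d ≤ a_{i-1} of β survives every move M(·, j) with j ≠ i,
-- so asc_d α ≤ asc_d β; the move at each d-ascent raises the running maximum, so
-- asc_d β ≤ max α; and max α ≤ asc_0 α for every 0-ascent sequence. So asc_d α ≤ asc_0 α, which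
-- together with 0-ascents ⊆ d-ascents makes the two ascent sets of α equal.
module Submission where

open import Defs
open import Data.Nat using (ℕ; _≤_)
open import Data.Product using (_×_)
open import Function.Bundles using (_⇔_)

open import Data.Nat using (zero; suc; _+_; _<_; _≤?_; _<?_; _⊔_; z≤n; s≤s; s≤s⁻¹; z<s)
open import Data.Nat.Properties
open import Data.List using (List; []; _∷_; _++_; _∷ʳ_; length)
open import Data.List.Properties using (length-++; ++-assoc; ++-identityʳ; foldl-++; length-++-≤ˡ)
open import Data.List.Relation.Unary.All as All using (All; []; _∷_)
open import Data.Bool using (Bool; true; false; if_then_else_)
open import Data.Product using (Σ; ∃₂; _,_)
open import Data.Sum using (inj₁; inj₂)
open import Data.Unit using (tt)
open import Relation.Nullary using (¬_; yes; no; does; contradiction)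
open import Relation.Nullary.Decidable using (dec-true; dec-false)
open import Relation.Binary using (tri<; tri≈; tri>)
open import Relation.Binary.PropositionalEquality
open import Function.Bundles using (mk⇔; Equivalence)

private
  variable
    d k m s : ℕ
    α β : Word

select : (ℕ → Bool) → ℕ → ℕ → List ℕ
select f s zero    = []
select f s (suc k) = if f s then s ∷ select f (suc s) k else select f (suc s) k

ascents≡select : ∀ d α s k → ascListFrom d α s k ≡ select (isAscB d α) s k
ascents≡select d α s zero    = refl
ascents≡select d α s (suc k) rewrite ascents≡select d α (suc s) k = refl

module _ {P : ℕ → Set} where

  private
    InRange : ℕ → ℕ → Set
    InRange s k = ∀ {j} → s ≤ j → j < s + k → P j

  range-head : InRange s (suc k) → P s
  range-head {s} {k} h = h ≤-refl (m<m+n s z<s)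

  range-tail : InRange s (suc k) → InRange (suc s) k
  range-tail {s} {k} h {j} s<j j<s+k = h (<⇒≤ s<j) (subst (j <_) (sym (+-suc s k)) j<s+k)

select-cong : ∀ f g s k → (∀ {j} → s ≤ j → j < s + k → f j ≡ g j) → select f s k ≡ select g s k
select-cong f g s zero    _ = refl
select-cong f g s (suc k) h
  rewrite range-head h | select-cong f g (suc s) k (range-tail h) = refl

length-select-mono : ∀ f g s k → (∀ {j} → s ≤ j → j < s + k → f j ≡ true → g j ≡ true)
  → length (select f s k) ≤ length (select g s k)
length-select-mono f g s zero    _ = z≤n
length-select-mono f g s (suc k) h with f s in fs | g s in gs
... | true  | true  = s≤s (length-select-mono f g (suc s) k (range-tail h))
... | true  | false = contradiction (trans (sym (range-head h fs)) gs) λ ()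
... | false | true  = m≤n⇒m≤1+n (length-select-mono f g (suc s) k (range-tail h))
... | false | false = length-select-mono f g (suc s) k (range-tail h)

select-complete : ∀ f g s k → (∀ {j} → s ≤ j → j < s + k → f j ≡ true → g j ≡ true)
  → length (select g s k) ≤ length (select f s k)
  → ∀ {j} → s ≤ j → j < s + k → g j ≡ true → f j ≡ true
select-complete f g s zero _ _ s≤j j<s+0 _ =
  contradiction (<-≤-trans j<s+0 (≤-trans (≤-reflexive (+-identityʳ s)) s≤j)) (n≮n _)
select-complete f g s (suc k) h len {j} s≤j j<s+k gj with f s in fs | g s in gs | m≤n⇒m<n∨m≡n s≤j
... | true  | _     | inj₂ refl = fs
... | true  | true  | inj₁ s<j  = select-complete f g (suc s) k (range-tail h) (s≤s⁻¹ len) s<j j<s+k′ gj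
  where j<s+k′ = subst (j <_) (+-suc s k) j<s+k
... | true  | false | inj₁ _    = contradiction (trans (sym (range-head h fs)) gs) λ ()
... | false | true  | _         =
  contradiction (≤-trans len (length-select-mono f g (suc s) k (range-tail h))) 1+n≰n
... | false | false | inj₂ refl = contradiction (trans (sym gj) gs) λ ()
... | false | false | inj₁ s<j  = select-complete f g (suc s) k (range-tail h) len s<j j<s+k′ gj
  where j<s+k′ = subst (j <_) (+-suc s k) j<s+k

select-++ : ∀ f s k l → select f s (k + l) ≡ select f s k ++ select f (s + k) l
select-++ f s zero    l = cong (λ t → select f t l) (sym (+-identityʳ s))
select-++ f s (suc k) l with f s
... | true  = cong (s ∷_) (trans (select-++ f (suc s) k l) shift)
  where shift = cong (λ t → select f (suc s) k ++ select f t l) (sym (+-suc s k))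
... | false = trans (select-++ f (suc s) k l) shift
  where shift = cong (λ t → select f (suc s) k ++ select f t l) (sym (+-suc s k))

select-sound : ∀ f s k → All (λ j → f j ≡ true) (select f s k)
select-sound f s zero    = []
select-sound f s (suc k) with f s in fs
... | true  = fs ∷ select-sound f (suc s) k
... | false = select-sound f (suc s) k

select-split : ∀ f s k {i} → f i ≡ true → s ≤ i → i < s + k
  → ∃₂ λ before after → select f s k ≡ before ++ i ∷ after × All (_< i) before
select-split f s zero fi s≤i i<s+0 =
  contradiction (<-≤-trans i<s+0 (≤-trans (≤-reflexive (+-identityʳ s)) s≤i)) (n≮n _)
select-split f s (suc k) {i} fi s≤i i<s+k with m≤n⇒m<n∨m≡n s≤i
... | inj₂ refl rewrite fi = [] , select f (suc s) k , refl , []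
... | inj₁ s<i with select-split f (suc s) k fi s<i (subst (i <_) (+-suc s k) i<s+k)
...   | before , after , eq , before<i with f s
...     | true  = s ∷ before , after , cong (s ∷_) eq , s<i ∷ before<i
...     | false = before , after , eq , before<i

at-++ˡ : ∀ pre ys {q} → q ≤ length pre → at (pre ++ ys) q ≡ at pre q
at-++ˡ []       []       {zero}          _ = refl
at-++ˡ []       (_ ∷ _)  {zero}          _ = refl
at-++ˡ (x ∷ xs) ys       {zero}          _ = refl
at-++ˡ (x ∷ xs) ys       {suc zero}      _ = refl
at-++ˡ (x ∷ xs) ys       {suc (suc q)} (s≤s q≤n) = at-++ˡ xs ys q≤n

at-∷ʳ : ∀ pre x → at (pre ∷ʳ x) (suc (length pre)) ≡ x
at-∷ʳ []           x = refl
at-∷ʳ (y ∷ [])     x = refl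
at-∷ʳ (y ∷ z ∷ ys) x = at-∷ʳ (z ∷ ys) x

at-beyond : ∀ γ {q} → length γ < q → at γ q ≡ 0
at-beyond []       _ = refl
at-beyond (x ∷ xs) {suc zero}    (s≤s ())
at-beyond (x ∷ xs) {suc (suc q)} (s≤s n<q) = at-beyond xs n<q

nonAscent⇒descent : isAscB d α (suc (suc m)) ≡ false → at α (suc (suc m)) + d ≤ at α (suc m)
nonAscent⇒descent {d} {α} {m} e =
  ≮⇒≥ λ ascent → contradiction (trans (sym (dec-true (at α (suc m) <? _) ascent)) e) λ ()

descent⇒nonAscent : at α (suc (suc m)) + d ≤ at α (suc m) → isAscB d α (suc (suc m)) ≡ false
descent⇒nonAscent descent = dec-false (_ <? _) (≤⇒≯ descent)

isAscB-mono : k ≤ d → ∀ α j → isAscB k α j ≡ true → isAscB d α j ≡ true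
isAscB-mono _ α (suc zero) _ = refl
isAscB-mono {k} {d} k≤d α (suc (suc i)) e with at α (suc i) <? at α (suc (suc i)) + k
... | yes ascent = dec-true (_ <? _) (<-≤-trans ascent (+-monoʳ-≤ _ k≤d))
... | no ¬ascent = contradiction (trans (sym e) (dec-false (at α (suc i) <? _) ¬ascent)) λ ()

isAscB-++ : ∀ d pre ys {j} → j ≤ length pre → isAscB d (pre ++ ys) j ≡ isAscB d pre j
isAscB-++ d pre ys {zero}        _   = refl
isAscB-++ d pre ys {suc zero}    _   = refl
isAscB-++ d pre ys {suc (suc i)} j≤n
  rewrite at-++ˡ pre ys (<⇒≤ j≤n) | at-++ˡ pre ys j≤n = refl

ascents-∷ʳ : ∀ d pre x
  → ascents d (pre ∷ʳ x) ≡ ascents d pre ++ select (isAscB d (pre ∷ʳ x)) (suc (length pre)) 1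
ascents-∷ʳ d pre x = begin
  ascListFrom d w 1 (length w)   ≡⟨ ascents≡select d w 1 (length w) ⟩
  select g 1 (length w)          ≡⟨ cong (select g 1) (length-++ pre) ⟩
  select g 1 (length pre + 1)    ≡⟨ select-++ g 1 (length pre) 1 ⟩
  select g 1 (length pre) ++ last
    ≡⟨ cong (_++ last) (select-cong g _ 1 (length pre) λ _ j≤n → isAscB-++ d pre _ (s≤s⁻¹ j≤n)) ⟩
  select (isAscB d pre) 1 (length pre) ++ last
    ≡⟨ cong (_++ last) (sym (ascents≡select d pre 1 (length pre))) ⟩
  ascents d pre ++ last                        ∎
  where
    open ≡-Reasoning
    w = pre ∷ʳ x
    g = isAscB d w
    last = select g (suc (length pre)) 1

bump : ℕ → ℕ → ℕ
bump v x = if does (v ≤? x) then suc x else x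

bump-≥ : ∀ {v x} → v ≤ x → bump v x ≡ suc x
bump-≥ {v} {x} v≤x rewrite dec-true (v ≤? x) v≤x = refl

bump-< : ∀ {v x} → ¬ v ≤ x → bump v x ≡ x
bump-< {v} {x} v≰x rewrite dec-false (v ≤? x) v≰x = refl

x≤bump : ∀ v x → x ≤ bump v x
x≤bump v x with v ≤? x
... | yes v≤x = ≤-trans (n≤1+n x) (≤-reflexive (sym (bump-≥ v≤x)))
... | no v≰x  = ≤-reflexive (sym (bump-< v≰x))

bump-preserves-gap : ∀ v {x y} d → x + d ≤ y → bump v x + d ≤ bump v y
bump-preserves-gap v {x} {y} d x+d≤y with v ≤? x | v ≤? y
... | yes v≤x | yes v≤y rewrite bump-≥ v≤x | bump-≥ v≤y = s≤s x+d≤y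
... | yes v≤x | no v≰y  = contradiction (≤-trans v≤x (≤-trans (m≤m+n x d) x+d≤y)) v≰y
... | no v≰x  | yes v≤y rewrite bump-< v≰x | bump-≥ v≤y = m≤n⇒m≤1+n x+d≤y
... | no v≰x  | no v≰y  rewrite bump-< v≰x | bump-< v≰y = x+d≤y

length-Mgo : ∀ v γ j → length (Mgo v γ j) ≡ length γ
length-Mgo v []       j             = refl
length-Mgo v (x ∷ xs) zero          = refl
length-Mgo v (x ∷ xs) (suc zero)    = refl
length-Mgo v (x ∷ xs) (suc (suc j)) = cong suc (length-Mgo v xs (suc j))

length-Ms : ∀ γ js → length (Ms γ js) ≡ length γ
length-Ms γ []       = refl
length-Ms γ (j ∷ js) = trans (length-Ms (M γ j) js) (length-Mgo (at γ j) γ j)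

at-Mgo-≥ : ∀ v γ {j q} → j ≤ q → at (Mgo v γ j) q ≡ at γ q
at-Mgo-≥ v []       _ = refl
at-Mgo-≥ v (x ∷ xs) {zero}        _ = refl
at-Mgo-≥ v (x ∷ xs) {suc zero}    _ = refl
at-Mgo-≥ v (x ∷ xs) {suc (suc j)} {suc (suc q)} (s≤s j≤q) = at-Mgo-≥ v xs j≤q

at-Mgo-< : ∀ v γ {i j} → i < j → suc i ≤ length γ → at (Mgo v γ (suc j)) (suc i) ≡ bump v (at γ (suc i))
at-Mgo-< v (x ∷ xs) {zero}  {suc j} _         _         = refl
at-Mgo-< v (x ∷ xs) {suc i} {suc j} (s≤s i<j) (s≤s i<n) = at-Mgo-< v xs i<j i<n

at≤at-Mgo : ∀ v γ j q → at γ q ≤ at (Mgo v γ j) q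
at≤at-Mgo v []       j             q             = ≤-refl
at≤at-Mgo v (x ∷ xs) zero          q             = ≤-refl
at≤at-Mgo v (x ∷ xs) (suc zero)    q             = ≤-refl
at≤at-Mgo v (x ∷ xs) (suc (suc j)) zero          = ≤-refl
at≤at-Mgo v (x ∷ xs) (suc (suc j)) (suc zero)    = x≤bump v x
at≤at-Mgo v (x ∷ xs) (suc (suc j)) (suc (suc q)) = at≤at-Mgo v xs (suc j) (suc q)

at≤at-Ms : ∀ γ js q → at γ q ≤ at (Ms γ js) q
at≤at-Ms γ []       q = ≤-refl
at≤at-Ms γ (j ∷ js) q = ≤-trans (at≤at-Mgo (at γ j) γ j q) (at≤at-Ms (M γ j) js q)

at-Ms-≥ : ∀ γ js {q} → All (_≤ q) js → at (Ms γ js) q ≡ at γ q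
at-Ms-≥ γ []       []            = refl
at-Ms-≥ γ (j ∷ js) (j≤q ∷ js≤q) = trans (at-Ms-≥ (M γ j) js js≤q) (at-Mgo-≥ (at γ j) γ j≤q)

M-raises : ∀ γ {i j} → at γ (suc j) ≤ at γ (suc i) → i < j → suc i ≤ length γ
  → at (M γ (suc j)) (suc i) ≡ suc (at γ (suc i))
M-raises γ aj≤ai i<j i<n = trans (at-Mgo-< _ γ i<j i<n) (bump-≥ aj≤ai)

Positive : Word → Set
Positive = All (1 ≤_)

Mgo-positive : ∀ v γ j → Positive γ → Positive (Mgo v γ j)
Mgo-positive v []       j             p = p
Mgo-positive v (x ∷ xs) zero          p = p
Mgo-positive v (x ∷ xs) (suc zero)    p = p
Mgo-positive v (x ∷ xs) (suc (suc j)) (px ∷ ps) = ≤-trans px (x≤bump v x) ∷ Mgo-positive v xs (suc j) ps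

at-positive : ∀ γ {q} → Positive γ → 1 ≤ q → q ≤ length γ → 1 ≤ at γ q
at-positive (x ∷ xs) {suc zero}    (px ∷ _)  _ _          = px
at-positive (x ∷ xs) {suc (suc q)} (_  ∷ ps) _ (s≤s q<n) = at-positive xs ps (s≤s z≤n) q<n

ascSeq⇒positive : ∀ d pre xs → isAscSeqAux d pre xs → Positive xs
ascSeq⇒positive d pre []       _              = []
ascSeq⇒positive d pre (x ∷ xs) (1≤x , _ , r) = 1≤x ∷ ascSeq⇒positive d (pre ∷ʳ x) xs r

-- Fixed points of hat_d

Ms-raises-before-descent : ∀ γ before after → All (_< suc (suc m)) before → suc (suc m) ≤ length γ
  → at γ (suc (suc m)) ≤ at γ (suc m) → at γ (suc m) < at (Ms γ (before ++ suc (suc m) ∷ after)) (suc m)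
Ms-raises-before-descent {m} γ before after before<i i≤n ai≤ai-1 = begin-strict
  at γ (suc m)                   ≡⟨ sym (at-Ms-≥ γ before before≤i-1) ⟩
  at δ (suc m)                   <⟨ ≤-reflexive (sym (M-raises δ δi≤δi-1 ≤-refl i-1≤length)) ⟩
  at (M δ (suc (suc m))) (suc m) ≤⟨ at≤at-Ms (M δ (suc (suc m))) after (suc m) ⟩
  at (Ms δ (suc (suc m) ∷ after)) (suc m)
    ≡⟨ cong (λ w → at w (suc m)) (sym (foldl-++ M γ before (suc (suc m) ∷ after))) ⟩
  at (Ms γ (before ++ suc (suc m) ∷ after)) (suc m) ∎
  where
    open ≤-Reasoning
    δ = Ms γ before
    before≤i-1 = All.map s≤s⁻¹ before<i
    δi≤δi-1 : at δ (suc (suc m)) ≤ at δ (suc m)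
    δi≤δi-1 = subst₂ _≤_ (sym (at-Ms-≥ γ before (All.map <⇒≤ before<i)))
                         (sym (at-Ms-≥ γ before before≤i-1)) ai≤ai-1
    i-1≤length : suc m ≤ length δ
    i-1≤length = subst (suc m ≤_) (sym (length-Ms γ before)) (<⇒≤ i≤n)

hat-raises-before-descent : isAscB d α (suc (suc m)) ≡ true → suc (suc m) ≤ length α
  → at α (suc (suc m)) ≤ at α (suc m) → at α (suc m) < at (hat d α) (suc m)
hat-raises-before-descent {d} {α} {m} ascent i≤n ai≤ai-1
  with before , after , split , before<i
         ← select-split (isAscB d α) 1 (length α) ascent (s≤s z≤n) (s≤s i≤n)
  rewrite ascents≡select d α 1 (length α) | split =
    Ms-raises-before-descent α before after before<i i≤n ai≤ai-1

hat-fixed⇒ascent₀ : hat d α ≡ α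
  → ∀ {j} → j ≤ length α → isAscB d α j ≡ true → isAscB 0 α j ≡ true
hat-fixed⇒ascent₀ _ {suc zero} _ _ = refl
hat-fixed⇒ascent₀ {d} {α} fixed {suc (suc m)} j≤n ascent with isAscB 0 α (suc (suc m)) in e
... | true  = refl
... | false = contradiction (subst (λ w → at α (suc m) < at w (suc m)) fixed raised) (n≮n _)
  where
    raised = hat-raises-before-descent {d = d} {α = α} ascent j≤n
               (subst (_≤ at α (suc m)) (+-identityʳ _) (nonAscent⇒descent {α = α} e))

-- Descents survive hat_d

-- Moves at j ≠ i shift a_{i-1} and a_i together or not at all.
M-preserves-descent : ∀ γ {j} → j ≢ suc (suc m)
  → at γ (suc (suc m)) + d ≤ at γ (suc m) → at (M γ j) (suc (suc m)) + d ≤ at (M γ j) (suc m)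
M-preserves-descent {m} γ {zero} _ gap
  rewrite at-Mgo-≥ (at γ 0) γ {q = suc (suc m)} z≤n | at-Mgo-≥ (at γ 0) γ {q = suc m} z≤n = gap
M-preserves-descent {m} {d} γ {suc j} j≢i gap with <-cmp j (suc m)
... | tri< j<i _ _ rewrite at-Mgo-≥ (at γ (suc j)) γ (m≤n⇒m≤1+n j<i) | at-Mgo-≥ (at γ (suc j)) γ j<i = gap
... | tri≈ _ j≡i _ = contradiction (cong suc j≡i) j≢i
... | tri> _ _ i<j with suc (suc m) ≤? length γ
...   | yes i≤n
  rewrite at-Mgo-< (at γ (suc j)) γ i<j i≤n | at-Mgo-< (at γ (suc j)) γ (<-trans (n<1+n m) i<j) (<⇒≤ i≤n)
  = bump-preserves-gap (at γ (suc j)) d gap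
...   | no i≰n
  rewrite at-beyond (M γ (suc j)) (subst (_< suc (suc m)) (sym (length-Mgo _ γ (suc j))) (≰⇒> i≰n))
  = ≤-trans (subst (λ a → a + d ≤ at γ (suc m)) (at-beyond γ (≰⇒> i≰n)) gap)
            (at≤at-Mgo (at γ (suc j)) γ (suc j) (suc m))

Ms-preserves-nonAscent : ∀ γ js {i} → All (_≢ i) js
  → isAscB d γ i ≡ false → isAscB d (Ms γ js) i ≡ false
Ms-preserves-nonAscent γ []       []               e = e
Ms-preserves-nonAscent γ (j ∷ js) {zero} (_ ∷ js≢i) _ = refl
Ms-preserves-nonAscent γ (j ∷ js) {suc (suc m)} (j≢i ∷ js≢i) e =
  Ms-preserves-nonAscent (M γ j) js js≢i
    (descent⇒nonAscent {α = M γ j} (M-preserves-descent γ j≢i (nonAscent⇒descent {α = γ} e)))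

hat-ascent⇒ascent : ∀ d β j → isAscB d (hat d β) j ≡ true → isAscB d β j ≡ true
hat-ascent⇒ascent d β j ascent with isAscB d β j in e
... | true  = refl
... | false = contradiction (trans (sym ascent) (Ms-preserves-nonAscent β (ascents d β) moves≢j e)) λ ()
  where
    moves≢j : All (_≢ j) (ascents d β)
    moves≢j = subst (All (_≢ j)) (sym (ascents≡select d β 1 (length β)))
      (All.map (λ { fj refl → contradiction (trans (sym fj) e) λ () })
               (select-sound (isAscB d β) 1 (length β)))

asc-hat≤asc : ∀ d β → asc d (hat d β) ≤ asc d β
asc-hat≤asc d β = subst₂ _≤_
  (cong length (sym (trans (ascents≡select d h 1 (length h)) (cong (select _ 1) length-h))))
  (cong length (sym (ascents≡select d β 1 (length β))))
  (length-select-mono _ _ 1 (length β) λ {j} _ _ → hat-ascent⇒ascent d β j)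
  where
    h = hat d β
    length-h = length-Ms β (ascents d β)

-- Prefix maxima

maxUpTo : Word → ℕ → ℕ
maxUpTo γ zero    = 0
maxUpTo γ (suc n) = maxUpTo γ n ⊔ at γ (suc n)

maxEntry : Word → ℕ
maxEntry γ = maxUpTo γ (length γ)

at≤maxUpTo : ∀ γ {q} n → 1 ≤ q → q ≤ n → at γ q ≤ maxUpTo γ n
at≤maxUpTo γ zero    (s≤s _) ()
at≤maxUpTo γ (suc n) 1≤q q≤1+n with m≤n⇒m<n∨m≡n q≤1+n
... | inj₁ q≤n  = ≤-trans (at≤maxUpTo γ n 1≤q (s≤s⁻¹ q≤n)) (m≤m⊔n _ _)
... | inj₂ refl = m≤n⊔m _ _

maxUpTo-attained : ∀ γ n → 0 < maxUpTo γ n → Σ ℕ λ q → 1 ≤ q × q ≤ n × at γ q ≡ maxUpTo γ n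
maxUpTo-attained γ (suc n) pos with ⊔-sel (maxUpTo γ n) (at γ (suc n))
... | inj₂ e = suc n , s≤s z≤n , ≤-refl , sym e
... | inj₁ e with maxUpTo-attained γ n (subst (0 <_) e pos)
...   | q , 1≤q , q≤n , aq≡max = q , 1≤q , m≤n⇒m≤1+n q≤n , trans aq≡max (sym e)

maxUpTo-++ : ∀ pre ys n → n ≤ length pre → maxUpTo (pre ++ ys) n ≡ maxUpTo pre n
maxUpTo-++ pre ys zero    _   = refl
maxUpTo-++ pre ys (suc n) n<l = cong₂ _⊔_ (maxUpTo-++ pre ys n (<⇒≤ n<l)) (at-++ˡ pre ys n<l)

maxEntry-∷ʳ : ∀ pre x → maxEntry (pre ∷ʳ x) ≡ maxEntry pre ⊔ x
maxEntry-∷ʳ pre x = begin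
  maxUpTo w (length w)
    ≡⟨ cong (maxUpTo w) (trans (length-++ pre) (+-comm (length pre) 1)) ⟩
  maxUpTo w (length pre) ⊔ at w (suc (length pre))
    ≡⟨ cong₂ _⊔_ (maxUpTo-++ pre _ (length pre) ≤-refl) (at-∷ʳ pre x) ⟩
  maxEntry pre ⊔ x ∎
  where
    open ≡-Reasoning
    w = pre ∷ʳ x

-- The entry a_j is either above the earlier maximum, or some earlier maximal entry is raised.
maxUpTo-M : ∀ γ s → Positive γ → suc s ≤ length γ → suc (maxUpTo γ s) ≤ maxUpTo (M γ (suc s)) (suc s)
maxUpTo-M γ s pos j≤n with at γ (suc s) ≤? maxUpTo γ s
... | no aj≰max = ≤-trans (≰⇒> aj≰max)
                    (≤-trans (≤-reflexive (sym (at-Mgo-≥ _ γ ≤-refl))) (m≤n⊔m _ _))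
... | yes aj≤max with maxUpTo-attained γ s (<-≤-trans (at-positive γ pos (s≤s z≤n) j≤n) aj≤max)
...   | suc q , _ , q<j , aq≡max = begin
  suc (maxUpTo γ s)              ≡⟨ cong suc (sym aq≡max) ⟩
  suc (at γ (suc q))
    ≡⟨ sym (M-raises γ (subst (_ ≤_) (sym aq≡max) aj≤max) q<j (≤-trans q<j (<⇒≤ j≤n))) ⟩
  at (M γ (suc s)) (suc q)       ≤⟨ at≤maxUpTo (M γ (suc s)) s (s≤s z≤n) q<j ⟩
  maxUpTo (M γ (suc s)) s        ≤⟨ m≤m⊔n _ _ ⟩
  maxUpTo (M γ (suc s)) (suc s)  ∎
  where open ≤-Reasoning

maxUpTo-Ms-select : ∀ f s k γ → Positive γ → s + k ≤ length γ
  → maxUpTo γ s + length (select f (suc s) k) ≤ maxUpTo (Ms γ (select f (suc s) k)) (s + k)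
maxUpTo-Ms-select f s zero γ _ _ rewrite +-identityʳ (maxUpTo γ s) | +-identityʳ s = ≤-refl
maxUpTo-Ms-select f s (suc k) γ pos s+k<n with f (suc s)
... | true = begin
  maxUpTo γ s + suc (length rest)              ≡⟨ +-suc _ _ ⟩
  suc (maxUpTo γ s) + length rest
    ≤⟨ +-monoˡ-≤ _ (maxUpTo-M γ s pos (≤-trans (s≤s (m≤m+n s k)) s+k<n′)) ⟩
  maxUpTo (M γ (suc s)) (suc s) + length rest
    ≤⟨ maxUpTo-Ms-select f (suc s) k (M γ (suc s)) (Mgo-positive _ γ _ pos)
         (subst (_ ≤_) (sym (length-Mgo _ γ (suc s))) s+k<n′) ⟩
  maxUpTo (Ms (M γ (suc s)) rest) (suc s + k)  ≡⟨ cong (maxUpTo _) (sym (+-suc s k)) ⟩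
  maxUpTo (Ms (M γ (suc s)) rest) (s + suc k)  ∎
  where
    open ≤-Reasoning
    rest = select f (suc (suc s)) k
    s+k<n′ = subst (_≤ length γ) (+-suc s k) s+k<n
... | false = subst (maxUpTo γ s + length rest ≤_) (cong (maxUpTo (Ms γ rest)) (sym (+-suc s k)))
                (≤-trans (+-monoˡ-≤ (length rest) (m≤m⊔n (maxUpTo γ s) (at γ (suc s))))
                  (maxUpTo-Ms-select f (suc s) k γ pos (subst (_≤ length γ) (+-suc s k) s+k<n)))
  where rest = select f (suc (suc s)) k

asc≤maxEntry-hat : IsAscSeq d β → asc d β ≤ maxEntry (hat d β)
asc≤maxEntry-hat {d} {β} β-seq = begin
  asc d β                       ≡⟨ cong length ascents-β ⟩
  length (select g 1 n)         ≤⟨ maxUpTo-Ms-select g 0 n β (ascSeq⇒positive d [] β β-seq) ≤-refl ⟩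
  maxUpTo (Ms β (select g 1 n)) n ≡⟨ cong (λ js → maxUpTo (Ms β js) n) (sym ascents-β) ⟩
  maxUpTo (hat d β) n           ≡⟨ cong (maxUpTo _) (sym (length-Ms β (ascents d β))) ⟩
  maxEntry (hat d β)            ∎
  where
    open ≤-Reasoning
    n = length β
    g = isAscB d β
    ascents-β = ascents≡select d β 1 n

-- A new maximum entry x ≤ 1 + asc₀ forces asc₀ to grow, while an entry that is not a
-- 0-ascent is at most the previous entry.
maxEntry≤asc₀-∷ʳ : ∀ pre x → x ≤ 1 + asc 0 pre → maxEntry pre ≤ asc 0 pre
  → maxEntry (pre ∷ʳ x) ≤ asc 0 (pre ∷ʳ x)
maxEntry≤asc₀-∷ʳ pre x x≤ max≤
  rewrite maxEntry-∷ʳ pre x | ascents-∷ʳ 0 pre x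
        | length-++ (ascents 0 pre) {select (isAscB 0 (pre ∷ʳ x)) (suc (length pre)) 1}
  with isAscB 0 (pre ∷ʳ x) (suc (length pre)) in e
... | true  = ⊔-lub (≤-trans max≤ (m≤m+n _ 1)) (subst (x ≤_) (+-comm 1 _) x≤)
... | false rewrite +-identityʳ (asc 0 pre) = ⊔-lub max≤ (≤-trans (x≤last pre e) max≤)
  where
    x≤last : ∀ pre → isAscB 0 (pre ∷ʳ x) (suc (length pre)) ≡ false → x ≤ maxEntry pre
    x≤last (y ∷ ys) e = begin
      x                                   ≡⟨ sym (at-∷ʳ (y ∷ ys) x) ⟩
      at w (suc (suc (length ys)))        ≡⟨ sym (+-identityʳ _) ⟩
      at w (suc (suc (length ys))) + 0    ≤⟨ nonAscent⇒descent {α = w} e ⟩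
      at w (suc (length ys))              ≡⟨ at-++ˡ (y ∷ ys) _ ≤-refl ⟩
      at (y ∷ ys) (suc (length ys))       ≤⟨ at≤maxUpTo (y ∷ ys) (suc (length ys)) (s≤s z≤n) ≤-refl ⟩
      maxEntry (y ∷ ys)                   ∎
      where
        open ≤-Reasoning
        w = (y ∷ ys) ∷ʳ x

maxEntry≤asc₀ : ∀ pre xs → isAscSeqAux 0 pre xs → maxEntry pre ≤ asc 0 pre
  → maxEntry (pre ++ xs) ≤ asc 0 (pre ++ xs)
maxEntry≤asc₀ pre []       _               max≤ rewrite ++-identityʳ pre = max≤
maxEntry≤asc₀ pre (x ∷ xs) (_ , x≤ , rest) max≤ rewrite sym (++-assoc pre (x ∷ []) xs) =
  maxEntry≤asc₀ (pre ∷ʳ x) xs rest (maxEntry≤asc₀-∷ʳ pre x x≤ max≤)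

-- Words with the same k- and d-ascents

SameAscents : ℕ → ℕ → Word → Set
SameAscents k d α = ∀ {j} → j ≤ length α → isAscB k α j ≡ isAscB d α j

SameAscents-sym : SameAscents k d α → SameAscents d k α
SameAscents-sym same j≤n = sym (same j≤n)

SameAscents-++ : ∀ k d pre ys → SameAscents k d (pre ++ ys) → SameAscents k d pre
SameAscents-++ k d pre ys same {j} j≤n =
  trans (sym (isAscB-++ k pre ys j≤n))
        (trans (same (≤-trans j≤n (length-++-≤ˡ pre))) (isAscB-++ d pre ys j≤n))

ascents-cong : SameAscents k d α → ascents k α ≡ ascents d α
ascents-cong {k} {d} {α} same = begin
  ascents k α                           ≡⟨ ascents≡select k α 1 (length α) ⟩
  select (isAscB k α) 1 (length α)      ≡⟨ select-cong _ _ 1 (length α) (λ _ j≤n → same (s≤s⁻¹ j≤n)) ⟩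
  select (isAscB d α) 1 (length α)      ≡⟨ sym (ascents≡select d α 1 (length α)) ⟩
  ascents d α                           ∎
  where open ≡-Reasoning

isAscSeqAux-transfer : ∀ pre xs → SameAscents k d (pre ++ xs) → isAscSeqAux d pre xs → isAscSeqAux k pre xs
isAscSeqAux-transfer pre []       _    _               = tt
isAscSeqAux-transfer {k} {d} pre (x ∷ xs) same (1≤x , x≤ , rest) =
  1≤x ,
  subst (λ a → x ≤ 1 + a) (cong length (sym (ascents-cong (SameAscents-++ k d pre (x ∷ xs) same)))) x≤ ,
  isAscSeqAux-transfer (pre ∷ʳ x) xs (subst (SameAscents k d) (sym (++-assoc pre (x ∷ []) xs)) same) rest

InTilde-cong : SameAscents k d α → InTilde k α ⇔ InTilde d α
InTilde-cong {k} {d} {α} same = mk⇔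
  (λ (seq , fixed) → isAscSeqAux-transfer [] α (SameAscents-sym same) seq ,
                     trans (cong (Ms α) (sym (ascents-cong same))) fixed)
  (λ (seq , fixed) → isAscSeqAux-transfer [] α same seq ,
                     trans (cong (Ms α) (ascents-cong same)) fixed)

ascents-squeeze : k ≤ d → (∀ {j} → j ≤ length α → isAscB d α j ≡ true → isAscB 0 α j ≡ true)
  → SameAscents k d α
ascents-squeeze {k} {d} {α} k≤d d⇒0 {j} j≤n with isAscB d α j in e
... | true  = isAscB-mono z≤n α j (d⇒0 j≤n e)
... | false with isAscB k α j in e′
...   | true  = contradiction (trans (sym (isAscB-mono k≤d α j e′)) e) λ ()
...   | false = refl

ascent-count-squeeze : asc d α ≤ asc 0 α
  → ∀ {j} → j ≤ length α → isAscB d α j ≡ true → isAscB 0 α j ≡ true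
ascent-count-squeeze {d} {α} count {suc j} j≤n =
  select-complete (isAscB 0 α) (isAscB d α) 1 (length α) (λ {j} _ _ → isAscB-mono z≤n α j)
    (subst₂ _≤_ (cong length (ascents≡select d α 1 (length α)))
                (cong length (ascents≡select 0 α 1 (length α))) count)
    (s≤s z≤n) (s≤s j≤n)

tilde-mono : k ≤ d → InTilde d α → InTilde k α
tilde-mono k≤d t@(_ , fixed) =
  Equivalence.from (InTilde-cong (ascents-squeeze k≤d (hat-fixed⇒ascent₀ fixed))) t

tilde₀∩hat⊆tilde : InTilde 0 α → InHat d α → InTilde d α
tilde₀∩hat⊆tilde {d = d} t₀@(h-seq , _) (β , β-seq , refl) =
  Equivalence.to (InTilde-cong (ascents-squeeze z≤n (ascent-count-squeeze count))) t₀
  where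
    open ≤-Reasoning
    h = hat d β
    count : asc d h ≤ asc 0 h
    count = begin
      asc d h      ≤⟨ asc-hat≤asc d β ⟩
      asc d β      ≤⟨ asc≤maxEntry-hat β-seq ⟩
      maxEntry h   ≤⟨ maxEntry≤asc₀ [] h h-seq z≤n ⟩
      asc 0 h      ∎

theorem3p5 : (d : ℕ)
    → ((k : ℕ) → k ≤ d → (α : Word) → InTilde d α → InTilde k α)
    × ((α : Word) → InTilde d α ⇔ (InTilde 0 α × InHat d α))
theorem3p5 d =
  (λ k k≤d α → tilde-mono k≤d) ,
  λ α → mk⇔ (λ t → tilde-mono z≤n t , α , t)
            (λ (t₀ , α∈hat) → tilde₀∩hat⊆tilde t₀ α∈hat)
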